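{- There are $2^{\aleph_0}$ pairwise non-isomorphic biased partitions of $\mathbb{Z}^2$.
   Context: $\mathbb{Z}^2$ is the graph with edges $\{x,x+e_1\}$, $\{x,x+e_2\}$; $\Gamma(x)=\{x\pm e_1,x\pm e_2\}$. A partition $\{X_i\}_{i\in[4]}$ of $\mathbb{Z}^2$ is biased if $|\Gamma(x)\cap X_i|=1$ for every $x\in\mathbb{Z}^2$ and $i\in\{1,2,3,4\}$. Two biased partitions $\{X_i\},\{Y_i\}$ are isomorphic if there are a graph automorphism $\phi$ of $\mathbb{Z}^2$ and a permutation $\sigma$ of $\{1,2,3,4\}$ with $\phi(X_i)=Y_{\sigma(i)}$ for all $i$. -}

module Defs where

open import Data.Nat using (ℕ)
open import Data.Bool using (Bool)
open import Data.Integer using (ℤ; _+_; _-_; +_)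
open import Data.Product using (_×_; _,_; Σ)
open import Data.Fin using (Fin)
open import Data.Fin.Properties using (_≟_)
open import Data.Fin.Permutation using (Permutation′; _⟨$⟩ʳ_)
open import Data.List using (List; _∷_; []; length; filter)
open import Data.List.Membership.Propositional using (_∈_)
open import Relation.Binary.PropositionalEquality using (_≡_)
open import Relation.Nullary using (¬_)
open import Function.Bundles using (_⇔_)

ℤ² : Set
ℤ² = ℤ × ℤ

Γ : ℤ² → List ℤ²
Γ (a , b) = (a + + 1 , b) ∷ (a - + 1 , b) ∷ (a , b + + 1) ∷ (a , b - + 1) ∷ []

Adj : ℤ² → ℤ² → Set
Adj x y = y ∈ Γ x

-- A labelled partition {X_i}_{i ∈ [4]} of ℤ² is given by the map
-- c : ℤ² → Fin 4 with X_i = c⁻¹(i).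
Partition4 : Set
Partition4 = ℤ² → Fin 4

IsBiased : Partition4 → Set
IsBiased c = ∀ (x : ℤ²) (i : Fin 4) → length (filter (λ y → c y ≟ i) (Γ x)) ≡ 1

record BiasedPartition : Set where
  field
    colour : Partition4
    biased : IsBiased colour

record Automorphism : Set where
  field
    to   : ℤ² → ℤ²
    from : ℤ² → ℤ²
    from-to : ∀ x → from (to x) ≡ x
    to-from : ∀ x → to (from x) ≡ x
    adj  : ∀ x y → Adj x y ⇔ Adj (to x) (to y)

-- {X_i} ≅ {Y_i}: ∃ φ, σ with φ(X_i) = Y_{σ(i)}; since φ is a bijection this
-- is equivalent to Y-colour (φ x) ≡ σ (X-colour x) for all x.
record Isomorphic (P Q : BiasedPartition) : Set where
  field
    φ : Automorphism
    σ : Permutation′ 4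
    preserves : ∀ x → BiasedPartition.colour Q (Automorphism.to φ x)
                      ≡ σ ⟨$⟩ʳ BiasedPartition.colour P x

-- To every a : ℕ → Bool we attach a bi-infinite boolean sequence  seq a : ℤ → Bool,
-- symmetric about 0, equal to true at -1, 0, 1, and containing no other run of three
-- equal consecutive values; the bit a n is stored at distance  offset n  from that run.
-- The partition  colouring a  cuts ℤ² into the diagonal strips {2k ≤ x + y ≤ 2k + 1};
-- a point gets the colour (parity of k, parity of x xor ([x + y odd] ∧ seq a k)).
-- This colouring is biased because the four neighbours of a point always receive four
-- distinct colours.  An edge of the grid is monochromatic exactly when it lies inside a
-- strip and its direction (horizontal/vertical) equals the value  seq a k  of that strip.
--
-- The invariant separating the partitions is  Marked c n : some straight ray carries
-- monochromatic edges number 0, 1, 2 and  offset n.  Straightness (a unique common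
-- neighbour) is preserved by graph automorphisms and monochromatic edges by recolourings,
-- so Marked is an isomorphism invariant.  Along a straight ray the monochromatic edges
-- number 0, 1, 2 read three consecutive values of seq a, hence sit at the unique run;
-- edge  offset n  then reads a n.  Thus  Marked (colouring a) n  holds iff a n ≡ true,
-- and isomorphic partitions  colouring a ,  colouring b  force a = b pointwise.
module Submission where

open import Defs
open import Data.Nat using (ℕ; zero; suc; _*_)
import Data.Nat.Properties as ℕP
open import Data.Nat.GeneralisedArithmetic using (fold)
open import Data.Bool using (Bool; true; false; not; _xor_; _∧_; if_then_else_)
open import Data.Bool.Properties
  using (not-involutive; not-¬; ¬-not; not-distribˡ-xor; ⇔→≡)
  renaming (_≟_ to _≟𝔹_)
open import Data.Integer using (ℤ; _+_; _-_; +_; -[1+_])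
import Data.Integer.Properties as ℤP
open import Algebra.Properties.AbelianGroup ℤP.+-0-abelianGroup using (∙-cancelˡ)
open import Algebra.Properties.CommutativeSemigroup ℤP.+-commutativeSemigroup
  using (xy∙z≈xz∙y)
open import Data.Product using (Σ; _×_; _,_; proj₁; proj₂)
open import Data.Fin using (Fin; zero; suc)
open import Data.Fin.Properties using (_≟_; all?)
open import Data.Fin.Permutation using (_⟨$⟩ʳ_; _⟨$⟩ˡ_; inverseˡ; flip)
open import Data.List using (List; _∷_; []; length; filter; map)
open import Data.List.Relation.Unary.Any using (here; there)
open import Data.Empty using (⊥; ⊥-elim)
open import Relation.Binary.PropositionalEquality
open import Relation.Nullary using (¬_; Dec; yes; no; ¬?; does)
open import Relation.Nullary.Decidable using (from-yes; _×-dec_; _→-dec_)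
open import Function.Bundles using (_⇔_; mk⇔; Equivalence)

∀-Bool? : {P : Bool → Set} → (∀ b → Dec (P b)) → Dec (∀ b → P b)
∀-Bool? P? with P? false | P? true
... | yes f | yes t = yes λ { false → f ; true → t }
... | no ¬f | _     = no λ all → ¬f (all false)
... | _     | no ¬t = no λ all → ¬t (all true)

count : Fin 4 → List (Fin 4) → ℕ
count i xs = length (filter (_≟ i) xs)

Distinct : Fin 4 → Fin 4 → Fin 4 → Fin 4 → Set
Distinct c₀ c₁ c₂ c₃ =
  c₀ ≢ c₁ × c₀ ≢ c₂ × c₀ ≢ c₃ × c₁ ≢ c₂ × c₁ ≢ c₃ × c₂ ≢ c₃

distinct-once : ∀ c₀ c₁ c₂ c₃ i → Distinct c₀ c₁ c₂ c₃ →
                count i (c₀ ∷ c₁ ∷ c₂ ∷ c₃ ∷ []) ≡ 1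
distinct-once = from-yes (all? λ c₀ → all? λ c₁ → all? λ c₂ → all? λ c₃ → all? λ i →
  (¬? (c₀ ≟ c₁) ×-dec ¬? (c₀ ≟ c₂) ×-dec ¬? (c₀ ≟ c₃) ×-dec
   ¬? (c₁ ≟ c₂) ×-dec ¬? (c₁ ≟ c₃) ×-dec ¬? (c₂ ≟ c₃))
  →-dec (count i (c₀ ∷ c₁ ∷ c₂ ∷ c₃ ∷ []) ℕP.≟ 1))

-- The two bit identities behind the analysis of monochromatic edges (see colourOf).
edge-bit : ∀ o c t h → c xor (o ∧ t) ≡ (h xor c) xor (not o ∧ t) → t ≡ h
edge-bit = from-yes (∀-Bool? λ o → ∀-Bool? λ c → ∀-Bool? λ t → ∀-Bool? λ h →
  (c xor (o ∧ t) ≟𝔹 (h xor c) xor (not o ∧ t)) →-dec (t ≟𝔹 h))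

edge-bit-converse : ∀ o c t → c xor (o ∧ t) ≡ (t xor c) xor (not o ∧ t)
edge-bit-converse = from-yes (∀-Bool? λ o → ∀-Bool? λ c → ∀-Bool? λ t →
  c xor (o ∧ t) ≟𝔹 (t xor c) xor (not o ∧ t))

data Dir : Set where
  E W N S : Dir

step : Dir → ℤ² → ℤ²
step E (x , y) = (x + + 1 , y)
step W (x , y) = (x - + 1 , y)
step N (x , y) = (x , y + + 1)
step S (x , y) = (x , y - + 1)

opposite : Dir → Dir
opposite E = W
opposite W = E
opposite N = S
opposite S = N

adj-step : ∀ {u z} → Adj u z → Σ Dir λ d → z ≡ step d u
adj-step (here eq)                         = E , eq
adj-step (there (here eq))                 = W , eq
adj-step (there (there (here eq)))         = N , eq
adj-step (there (there (there (here eq)))) = S , eq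
adj-step (there (there (there (there ()))))

step-adj : ∀ d u → Adj u (step d u)
step-adj E u = here refl
step-adj W u = there (here refl)
step-adj N u = there (there (here refl))
step-adj S u = there (there (there (here refl)))

-- Moves are translations; the algebra of translations of ℤ² gives all facts about moves.
infixl 6 _⊞_
_⊞_ : ℤ² → ℤ² → ℤ²
(a , b) ⊞ (c , d) = (a + c , b + d)

δ : Dir → ℤ²
δ E = (+ 1 , + 0)
δ W = (-[1+ 0 ] , + 0)
δ N = (+ 0 , + 1)
δ S = (+ 0 , -[1+ 0 ])

step-δ : ∀ d p → step d p ≡ p ⊞ δ d
step-δ E (x , y) = cong (x + + 1 ,_) (sym (ℤP.+-identityʳ y))
step-δ W (x , y) = cong (x - + 1 ,_) (sym (ℤP.+-identityʳ y))
step-δ N (x , y) = cong (_, y + + 1) (sym (ℤP.+-identityʳ x))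
step-δ S (x , y) = cong (_, y - + 1) (sym (ℤP.+-identityʳ x))

⊞-assoc : ∀ p v w → p ⊞ v ⊞ w ≡ p ⊞ (v ⊞ w)
⊞-assoc (a , b) (c , d) (e , f) = cong₂ _,_ (ℤP.+-assoc a c e) (ℤP.+-assoc b d f)

⊞-comm : ∀ v w → v ⊞ w ≡ w ⊞ v
⊞-comm (a , b) (c , d) = cong₂ _,_ (ℤP.+-comm a c) (ℤP.+-comm b d)

⊞-identityʳ : ∀ p → p ⊞ (+ 0 , + 0) ≡ p
⊞-identityʳ (a , b) = cong₂ _,_ (ℤP.+-identityʳ a) (ℤP.+-identityʳ b)

⊞-cancelˡ : ∀ p {v w} → p ⊞ v ≡ p ⊞ w → v ≡ w
⊞-cancelˡ (a , b) eq =
  cong₂ _,_ (∙-cancelˡ a _ _ (cong proj₁ eq)) (∙-cancelˡ b _ _ (cong proj₂ eq))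

-- δ has a left inverse, hence is injective.
direction : ℤ² → Dir
direction (+ 1 , _)      = E
direction (-[1+ 0 ] , _) = W
direction (_ , + 1)      = N
direction _              = S

direction-δ : ∀ d → direction (δ d) ≡ d
direction-δ E = refl
direction-δ W = refl
direction-δ N = refl
direction-δ S = refl

δ-injective : ∀ {d d'} → δ d ≡ δ d' → d ≡ d'
δ-injective {d} {d'} eq = trans (sym (direction-δ d)) (trans (cong direction eq) (direction-δ d'))

δ-opposite : ∀ d → δ d ⊞ δ (opposite d) ≡ (+ 0 , + 0)
δ-opposite E = refl
δ-opposite W = refl
δ-opposite N = refl
δ-opposite S = refl

east-twice : ∀ d d' → δ d ⊞ δ d' ≡ δ E ⊞ δ E → d ≡ E
east-twice E _ _ = refl
east-twice W E ()
east-twice W W ()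
east-twice W N ()
east-twice W S ()
east-twice N E ()
east-twice N W ()
east-twice N N ()
east-twice N S ()
east-twice S E ()
east-twice S W ()
east-twice S N ()
east-twice S S ()

two-steps : ∀ d d' p → step d' (step d p) ≡ p ⊞ (δ d ⊞ δ d')
two-steps d d' p = begin
  step d' (step d p)    ≡⟨ step-δ d' (step d p) ⟩
  step d p ⊞ δ d'       ≡⟨ cong (_⊞ δ d') (step-δ d p) ⟩
  p ⊞ δ d ⊞ δ d'        ≡⟨ ⊞-assoc p (δ d) (δ d') ⟩
  p ⊞ (δ d ⊞ δ d')      ∎
  where open ≡-Reasoning

step-comm : ∀ d d' p → step d (step d' p) ≡ step d' (step d p)
step-comm d d' p =
  trans (two-steps d' d p) (trans (cong (p ⊞_) (⊞-comm (δ d') (δ d))) (sym (two-steps d d' p)))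

step-opposite : ∀ d p → step (opposite d) (step d p) ≡ p
step-opposite d p =
  trans (two-steps d (opposite d) p) (trans (cong (p ⊞_) (δ-opposite d)) (⊞-identityʳ p))

step-injective : ∀ d d' p → step d p ≡ step d' p → d ≡ d'
step-injective d d' p eq =
  δ-injective (⊞-cancelˡ p (trans (sym (step-δ d p)) (trans eq (step-δ d' p))))

adj-sym : ∀ {u z} → Adj u z → Adj z u
adj-sym {u} a with adj-step a
... | d , refl = subst (Adj (step d u)) (step-opposite d u) (step-adj (opposite d) (step d u))

-- u, v, w lie on a line: v is the unique common neighbour of the distinct vertices u, w.
-- This is phrased through adjacency alone, so automorphisms preserve it.
Straight : ℤ² → ℤ² → ℤ² → Set
Straight u v w = Adj u v × Adj v w × u ≢ w × (∀ z → Adj u z → Adj w z → z ≡ v)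

straight-east : ∀ u → Straight u (step E u) (step E (step E u))
straight-east u = step-adj E u , step-adj E (step E u) , moves , unique
  where
  moves : u ≢ step E (step E u)
  moves eq with ⊞-cancelˡ u (trans (⊞-identityʳ u) (trans eq (two-steps E E u)))
  ... | ()
  unique : ∀ z → Adj u z → Adj (step E (step E u)) z → z ≡ step E u
  unique z a₁ a₂ with adj-step a₁ | adj-step (adj-sym a₂)
  ... | d , refl | d' , eq = cong (λ e → step e u) (east-twice d d' (⊞-cancelˡ u
          (trans (sym (two-steps d d' u)) (trans (sym eq) (two-steps E E u)))))

-- A straight triple starting with a move in direction e continues in direction e:
-- otherwise the side vertex step e' u would be a second common neighbour.
straight-continues : ∀ e u w → Straight u (step e u) w → w ≡ step e (step e u)
straight-continues e u w (_ , a₂ , _ , unique) with adj-step a₂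
... | e' , refl = cong (λ d → step d (step e u)) e'≡e
  where
  side-adj : Adj (step e' (step e u)) (step e' u)
  side-adj = subst (Adj (step e' (step e u)))
    (trans (cong (step (opposite e)) (step-comm e' e u)) (step-opposite e (step e' u)))
    (step-adj (opposite e) (step e' (step e u)))
  e'≡e : e' ≡ e
  e'≡e = step-injective e' e u (unique (step e' u) (step-adj e' u) side-adj)

StraightRay : (ℕ → ℤ²) → Set
StraightRay p = ∀ i → Straight (p i) (p (suc i)) (p (suc (suc i)))

straight-ray : ∀ e p → StraightRay p → p 1 ≡ step e (p 0) → ∀ i → p (suc i) ≡ step e (p i)
straight-ray e p st first zero = first
straight-ray e p st first (suc i) =
  trans (straight-continues e (p i) (p (suc (suc i))) (subst (λ v → Straight (p i) v _) ray-i (st i)))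
        (cong (step e) (sym ray-i))
  where
  ray-i : p (suc i) ≡ step e (p i)
  ray-i = straight-ray e p st first i

-- Integers are grouped into pairs {2k, 2k + 1}; odd s tells whether s is the second
-- element of its pair and half s is the index k.
oddℕ : ℕ → Bool
oddℕ zero    = false
oddℕ (suc n) = not (oddℕ n)

halfℕ : ℕ → ℕ
halfℕ zero    = zero
halfℕ (suc n) = if oddℕ n then suc (halfℕ n) else halfℕ n

odd : ℤ → Bool
odd (+ n)    = oddℕ n
odd -[1+ n ] = not (oddℕ n)

half : ℤ → ℤ
half (+ n)    = + halfℕ n
half -[1+ n ] = -[1+ halfℕ n ]

-- successor and predecessor by pattern matching, so that odd and half compute along them
sucℤ : ℤ → ℤ
sucℤ (+ n)          = + suc n
sucℤ -[1+ zero ]    = + 0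
sucℤ -[1+ suc n ]   = -[1+ n ]

predℤ : ℤ → ℤ
predℤ (+ zero)    = -[1+ 0 ]
predℤ (+ suc n)   = + n
predℤ -[1+ n ]    = -[1+ suc n ]

+1≡sucℤ : ∀ x → x + + 1 ≡ sucℤ x
+1≡sucℤ (+ n)          = cong +_ (ℕP.+-comm n 1)
+1≡sucℤ -[1+ zero ]    = refl
+1≡sucℤ -[1+ suc n ]   = refl

-1≡predℤ : ∀ x → x - + 1 ≡ predℤ x
-1≡predℤ (+ zero)    = refl
-1≡predℤ (+ suc n)   = refl
-1≡predℤ -[1+ n ]    = cong (λ m → -[1+ suc m ]) (ℕP.+-identityʳ n)

sucℤ-predℤ : ∀ s → sucℤ (predℤ s) ≡ s
sucℤ-predℤ (+ zero)  = refl
sucℤ-predℤ (+ suc n) = refl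
sucℤ-predℤ -[1+ n ]  = refl

half-suc : ∀ x → half (sucℤ x) ≡ (if odd x then sucℤ (half x) else half x)
half-suc (+ n) with oddℕ n
... | true  = refl
... | false = refl
half-suc -[1+ zero ] = refl
half-suc -[1+ suc n ] with oddℕ n
... | true  = refl
... | false = refl

half-pred : ∀ x → half (predℤ x) ≡ (if odd x then half x else predℤ (half x))
half-pred (+ zero) = refl
half-pred (+ suc n) with oddℕ n | halfℕ n
... | true  | h     = refl
... | false | zero  = refl
... | false | suc h = refl
half-pred -[1+ n ] with oddℕ n
... | true  = refl
... | false = refl

move : Bool → ℤ → ℤ
move true  = sucℤ
move false = predℤ

odd-move : ∀ b s → odd (move b s) ≡ not (odd s)
odd-move true (+ n)            = refl
odd-move true -[1+ zero ]      = refl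
odd-move true -[1+ suc n ]     = sym (not-involutive _)
odd-move false (+ zero)        = refl
odd-move false (+ suc n)       = sym (not-involutive _)
odd-move false -[1+ n ]        = refl

half-within : ∀ b s → odd s ≡ not b → half (move b s) ≡ half s
half-within true s o  = trans (half-suc s) (cong (λ b → if b then sucℤ (half s) else half s) o)
half-within false s o = trans (half-pred s) (cong (λ b → if b then half s else predℤ (half s)) o)

half-across : ∀ b s → odd s ≡ b → half (move b s) ≡ move b (half s)
half-across true s o  = trans (half-suc s) (cong (λ b → if b then sucℤ (half s) else half s) o)
half-across false s o = trans (half-pred s) (cong (λ b → if b then half s else predℤ (half s)) o)

half-two-moves : ∀ b s → half (move b (move b s)) ≡ move b (half s)
half-two-moves b s with odd s ≟𝔹 b
... | yes across = trans (half-within b (move b s) (trans (odd-move b s) (cong not across)))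
                         (half-across b s across)
... | no ¬across = trans (half-across b (move b s)
                           (trans (odd-move b s) (trans (cong not (¬-not ¬across)) (not-involutive b))))
                         (cong (move b) (half-within b s (¬-not ¬across)))

blocks : (ℕ → Bool) → ℕ → Bool
blocks a zero                = false
blocks a (suc zero)          = a 0
blocks a (suc (suc zero))    = true
blocks a (suc (suc (suc j))) = blocks (λ n → a (suc n)) j

seqℕ : (ℕ → Bool) → ℕ → Bool
seqℕ a zero          = true
seqℕ a (suc zero)    = true
seqℕ a (suc (suc j)) = blocks a j

-- the symmetric extension to ℤ; its only run of three equal values is at -1, 0, 1
seq : (ℕ → Bool) → ℤ → Bool
seq a (+ n)    = seqℕ a n
seq a -[1+ n ] = seqℕ a (suc n)

blocks-no-run : ∀ a j → blocks a j ≡ blocks a (suc j) → blocks a (suc j) ≡ blocks a (suc (suc j)) → ⊥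
blocks-no-run a zero e₁ e₂ with trans e₁ e₂
... | ()
blocks-no-run a (suc zero) e₁ ()
blocks-no-run a (suc (suc zero)) () e₂
blocks-no-run a (suc (suc (suc j))) e₁ e₂ = blocks-no-run (λ n → a (suc n)) j e₁ e₂

seqℕ-no-run : ∀ a n → seqℕ a n ≡ seqℕ a (suc n) → seqℕ a (suc n) ≡ seqℕ a (suc (suc n)) → ⊥
seqℕ-no-run a zero e₁ ()
seqℕ-no-run a (suc zero) () e₂
seqℕ-no-run a (suc (suc j)) e₁ e₂ = blocks-no-run a j e₁ e₂

-- the end of the run -1, 0, 1 from which one enters it moving in direction b
start : Bool → ℤ
start true  = -[1+ 0 ]
start false = + 1

seq-start : ∀ a b → seq a (start b) ≡ true
seq-start a true  = refl
seq-start a false = refl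

run-start : ∀ a b k → seq a k ≡ seq a (move b k) → seq a (move b k) ≡ seq a (move b (move b k)) →
            k ≡ start b
run-start a true (+ n) e₁ e₂                  = ⊥-elim (seqℕ-no-run a n e₁ e₂)
run-start a true -[1+ zero ] e₁ e₂            = refl
run-start a true -[1+ suc zero ] () e₂
run-start a true -[1+ suc (suc m) ] e₁ e₂     = ⊥-elim (seqℕ-no-run a (suc m) (sym e₂) (sym e₁))
run-start a false (+ zero) e₁ ()
run-start a false (+ suc zero) e₁ e₂          = refl
run-start a false (+ suc (suc n)) e₁ e₂       = ⊥-elim (seqℕ-no-run a n (sym e₂) (sym e₁))
run-start a false -[1+ n ] e₁ e₂              = ⊥-elim (seqℕ-no-run a (suc n) e₁ e₂)

slot : ℕ → ℕ
slot zero    = 1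
slot (suc n) = suc (suc (suc (slot n)))

blocks-slot : ∀ a n → blocks a (slot n) ≡ a n
blocks-slot a zero    = refl
blocks-slot a (suc n) = blocks-slot (λ m → a (suc m)) n

offset : ℕ → ℕ
offset n = suc (suc (suc (slot n)))

-- positions reached by moving from start b (fold z f m applies f m times to z)
ascend-from-start : ∀ m → fold (start true) sucℤ (suc m) ≡ + m
ascend-from-start zero    = refl
ascend-from-start (suc m) = cong sucℤ (ascend-from-start m)

descend-from-start : ∀ m → fold (start false) predℤ (suc (suc m)) ≡ -[1+ m ]
descend-from-start zero    = refl
descend-from-start (suc m) = cong predℤ (descend-from-start m)

read : ∀ a b n → seq a (fold (start b) (move b) (offset n)) ≡ a n
read a true n  rewrite ascend-from-start (suc (suc (slot n)))  = blocks-slot a n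
read a false n rewrite descend-from-start (suc (slot n))       = blocks-slot a n

paint : Bool → Bool → Fin 4
paint false false = zero
paint false true  = suc zero
paint true  false = suc (suc zero)
paint true  true  = suc (suc (suc zero))

bits : Fin 4 → Bool × Bool
bits zero                   = false , false
bits (suc zero)             = false , true
bits (suc (suc zero))       = true , false
bits (suc (suc (suc zero))) = true , true

bits-paint : ∀ P u → bits (paint P u) ≡ (P , u)
bits-paint false false = refl
bits-paint false true  = refl
bits-paint true  false = refl
bits-paint true  true  = refl

paint-injective : ∀ {P u Q w} → paint P u ≡ paint Q w → P ≡ Q × u ≡ w
paint-injective {P} {u} {Q} {w} eq with trans (sym (bits-paint P u)) (trans (cong bits eq) (bits-paint Q w))
... | refl = refl , refl

-- colour of a point with x-parity c on the diagonal x + y = s, in the strip k = ⌊ s / 2 ⌋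
colourOf : (ℕ → Bool) → Bool → ℤ → Fin 4
colourOf a c s = paint (odd (half s)) (c xor (odd s ∧ seq a (half s)))

diag : ℤ² → ℤ
diag (x , y) = x + y

colouring : (ℕ → Bool) → ℤ² → Fin 4
colouring a p = colourOf a (odd (proj₁ p)) (diag p)

horizontal : Dir → Bool
horizontal E = true
horizontal W = true
horizontal N = false
horizontal S = false

ascending : Dir → Bool
ascending E = true
ascending W = false
ascending N = true
ascending S = false

diag-step : ∀ e p → diag (step e p) ≡ move (ascending e) (diag p)
diag-step E (x , y) = trans (xy∙z≈xz∙y x (+ 1) y) (+1≡sucℤ (x + y))
diag-step W (x , y) = trans (xy∙z≈xz∙y x -[1+ 0 ] y) (-1≡predℤ (x + y))
diag-step N (x , y) = trans (sym (ℤP.+-assoc x y (+ 1))) (+1≡sucℤ (x + y))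
diag-step S (x , y) = trans (sym (ℤP.+-assoc x y -[1+ 0 ])) (-1≡predℤ (x + y))

odd-step : ∀ e p → odd (proj₁ (step e p)) ≡ horizontal e xor odd (proj₁ p)
odd-step E (x , y) = trans (cong odd (+1≡sucℤ x)) (odd-move true x)
odd-step W (x , y) = trans (cong odd (-1≡predℤ x)) (odd-move false x)
odd-step N _       = refl
odd-step S _       = refl

colouring-step : ∀ a e p →
  colouring a (step e p) ≡ colourOf a (horizontal e xor odd (proj₁ p)) (move (ascending e) (diag p))
colouring-step a e p = cong₂ (colourOf a) (odd-step e p) (diag-step e p)

colourOf-flip : ∀ a c s → colourOf a c s ≢ colourOf a (not c) s
colourOf-flip a c s eq =
  not-¬ refl (trans (proj₂ (paint-injective eq)) (sym (not-distribˡ-xor c _)))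

-- The diagonals s + 1 and s - 1 lie in consecutive strips, so the first bits differ.
colourOf-sides : ∀ a c c' s → colourOf a c (sucℤ s) ≢ colourOf a c' (predℤ s)
colourOf-sides a c c' s eq = not-¬ refl (trans (sym (proj₁ (paint-injective eq))) next-strip)
  where
  next-strip : odd (half (sucℤ s)) ≡ not (odd (half (predℤ s)))
  next-strip = trans (cong (λ t → odd (half t)) (sym (cong sucℤ (sucℤ-predℤ s))))
                     (trans (cong odd (half-two-moves true (predℤ s))) (odd-move true (half (predℤ s))))

neighbours-distinct : ∀ a c s →
  Distinct (colourOf a (not c) (sucℤ s)) (colourOf a (not c) (predℤ s))
           (colourOf a c (sucℤ s)) (colourOf a c (predℤ s))
neighbours-distinct a c s =
  colourOf-sides a (not c) (not c) s , (λ eq → colourOf-flip a c (sucℤ s) (sym eq)) ,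
  colourOf-sides a (not c) c s , (λ eq → colourOf-sides a c (not c) s (sym eq)) ,
  (λ eq → colourOf-flip a c (predℤ s) (sym eq)) , colourOf-sides a c c s

count-map : ∀ (c : ℤ² → Fin 4) i ys → length (filter (λ y → c y ≟ i) ys) ≡ count i (map c ys)
count-map c i [] = refl
count-map c i (y ∷ ys) with does (c y ≟ i)
... | true  = cong suc (count-map c i ys)
... | false = count-map c i ys

biased : ∀ a → IsBiased (colouring a)
biased a x i = trans (count-map (colouring a) i (Γ x))
  (trans (cong (count i) neighbour-colours)
         (distinct-once _ _ _ _ i (neighbours-distinct a (odd (proj₁ x)) (diag x))))
  where
  neighbour-colours : map (colouring a) (Γ x) ≡
    colourOf a (not (odd (proj₁ x))) (sucℤ (diag x)) ∷ colourOf a (not (odd (proj₁ x))) (predℤ (diag x)) ∷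
    colourOf a (odd (proj₁ x)) (sucℤ (diag x)) ∷ colourOf a (odd (proj₁ x)) (predℤ (diag x)) ∷ []
  neighbour-colours = cong₂ _∷_ (colouring-step a E x) (cong₂ _∷_ (colouring-step a W x)
                        (cong₂ _∷_ (colouring-step a N x) (cong₂ _∷_ (colouring-step a S x) refl)))

partitionOf : (ℕ → Bool) → BiasedPartition
partitionOf a = record { colour = colouring a ; biased = biased a }

colourOf-mono : ∀ a b h c s → colourOf a c s ≡ colourOf a (h xor c) (move b s) →
                odd s ≡ not b × seq a (half s) ≡ h
colourOf-mono a b h c s eq = within , edge-bit (odd s) c (seq a (half s)) h second
  where
  same-bits : odd (half s) ≡ odd (half (move b s)) ×
              c xor (odd s ∧ seq a (half s)) ≡ (h xor c) xor (odd (move b s) ∧ seq a (half (move b s)))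
  same-bits = paint-injective eq
  within : odd s ≡ not b
  within = ¬-not λ across → not-¬ refl
    (trans (proj₁ same-bits) (trans (cong odd (half-across b s across)) (odd-move b (half s))))
  second : c xor (odd s ∧ seq a (half s)) ≡ (h xor c) xor (not (odd s) ∧ seq a (half s))
  second = trans (proj₂ same-bits)
    (cong₂ (λ o k → (h xor c) xor (o ∧ seq a k)) (odd-move b s) (half-within b s within))

mono-colourOf : ∀ a b c s → odd s ≡ not b →
                colourOf a c s ≡ colourOf a (seq a (half s) xor c) (move b s)
mono-colourOf a b c s within = cong₂ paint (cong odd (sym stays))
  (trans (edge-bit-converse (odd s) c (seq a (half s)))
         (sym (cong₂ (λ o k → (seq a (half s) xor c) xor (o ∧ seq a k)) (odd-move b s) stays)))
  where
  stays : half (move b s) ≡ half s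
  stays = half-within b s within

mono-step : ∀ a e p → colouring a p ≡ colouring a (step e p) →
            odd (diag p) ≡ not (ascending e) × seq a (half (diag p)) ≡ horizontal e
mono-step a e p eq =
  colourOf-mono a (ascending e) (horizontal e) (odd (proj₁ p)) (diag p) (trans eq (colouring-step a e p))

step-mono : ∀ a e p → odd (diag p) ≡ not (ascending e) → seq a (half (diag p)) ≡ horizontal e →
            colouring a p ≡ colouring a (step e p)
step-mono a e p within value = trans
  (subst (λ h → colouring a p ≡ colourOf a (h xor odd (proj₁ p)) (move (ascending e) (diag p))) value
         (mono-colourOf a (ascending e) (odd (proj₁ p)) (diag p) within))
  (sym (colouring-step a e p))

ray-strips : ∀ e (p : ℕ → ℤ²) → (∀ i → p (suc i) ≡ step e (p i)) → odd (diag (p 0)) ≡ not (ascending e) →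
  ∀ j → odd (diag (p (2 * j))) ≡ not (ascending e) ×
        half (diag (p (2 * j))) ≡ fold (half (diag (p 0))) (move (ascending e)) j
ray-strips e p ray o₀ zero = o₀ , refl
ray-strips e p ray o₀ (suc j) = subst Begins (sym two-later) (odd-two , half-two)
  where
  b : Bool
  b = ascending e
  Begins : ℤ → Set
  Begins t = odd t ≡ not b × half t ≡ move b (fold (half (diag (p 0))) (move b) j)
  previous : odd (diag (p (2 * j))) ≡ not b × half (diag (p (2 * j))) ≡ fold (half (diag (p 0))) (move b) j
  previous = ray-strips e p ray o₀ j
  s : ℤ
  s = diag (p (2 * j))
  diag-ray : ∀ i → diag (p (suc i)) ≡ move b (diag (p i))
  diag-ray i = trans (cong diag (ray i)) (diag-step e (p i))
  two-later : diag (p (2 * suc j)) ≡ move b (move b s)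
  two-later = trans (cong (λ i → diag (p i)) (ℕP.*-suc 2 j))
                    (trans (diag-ray (suc (2 * j))) (cong (move b) (diag-ray (2 * j))))
  odd-two : odd (move b (move b s)) ≡ not b
  odd-two = trans (odd-move b _) (trans (cong not (odd-move b s)) (trans (not-involutive _) (proj₁ previous)))
  half-two : half (move b (move b s)) ≡ move b (fold (half (diag (p 0))) (move b) j)
  half-two = trans (half-two-moves b s) (cong (move b) (proj₂ previous))

MonoEdge : (ℤ² → Fin 4) → (ℕ → ℤ²) → ℕ → Set
MonoEdge c p j = c (p (2 * j)) ≡ c (p (suc (2 * j)))

Marked : (ℤ² → Fin 4) → ℕ → Set
Marked c n = Σ (ℕ → ℤ²) λ p →
  StraightRay p × MonoEdge c p 0 × MonoEdge c p 1 × MonoEdge c p 2 × MonoEdge c p (offset n)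

-- The eastward ray from (-2, 0) starts the strip k = -1 and meets seq a at -1, 0, 1, …
marked-of : ∀ a n → a n ≡ true → Marked (colouring a) n
marked-of a n an = p , (λ i → straight-east (p i)) , edge 0 refl , edge 1 refl , edge 2 refl ,
                   edge (offset n) (trans (read a true n) an)
  where
  p : ℕ → ℤ²
  p = fold (-[1+ 1 ] , + 0) (step E)
  edge : ∀ j → seq a (fold (start true) sucℤ j) ≡ true → MonoEdge (colouring a) p j
  edge j value = step-mono a E (p (2 * j)) (proj₁ strip)
    (trans (cong (seq a) (proj₂ strip)) value)
    where
    strip : odd (diag (p (2 * j))) ≡ false × half (diag (p (2 * j))) ≡ fold (start true) sucℤ j
    strip = ray-strips E p (λ _ → refl) refl j

-- On a marked straight ray, edges 0, 1, 2 see three equal values of seq a, so they sit at the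
-- central run; the value read at edge offset n is then a n and equals the run value true.
marked-reads : ∀ a n → Marked (colouring a) n → a n ≡ true
marked-reads a n (p , st , m₀ , m₁ , m₂ , mₙ) with adj-step (proj₁ (st 0))
... | e , first = begin
  a n                                         ≡⟨ sym (read a b n) ⟩
  seq a (fold (start b) (move b) (offset n))  ≡⟨ cong (λ t → seq a (fold t (move b) (offset n))) (sym at-start) ⟩
  seq a (fold k (move b) (offset n))          ≡⟨ edge-value (offset n) mₙ ⟩
  horizontal e                                ≡⟨ sym (edge-value 0 m₀) ⟩
  seq a k                                     ≡⟨ cong (seq a) at-start ⟩
  seq a (start b)                             ≡⟨ seq-start a b ⟩
  true                                        ∎
  where
  open ≡-Reasoning
  b : Bool
  b = ascending e
  k : ℤ
  k = half (diag (p 0))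
  ray : ∀ i → p (suc i) ≡ step e (p i)
  ray = straight-ray e p st first
  strips : ∀ j → odd (diag (p (2 * j))) ≡ not b × half (diag (p (2 * j))) ≡ fold k (move b) j
  strips = ray-strips e p ray (proj₁ (mono-step a e (p 0) (trans m₀ (cong (colouring a) first))))
  edge-value : ∀ j → MonoEdge (colouring a) p j → seq a (fold k (move b) j) ≡ horizontal e
  edge-value j m = trans (cong (seq a) (sym (proj₂ (strips j))))
    (proj₂ (mono-step a e (p (2 * j)) (trans m (cong (colouring a) (ray (2 * j))))))
  at-start : k ≡ start b
  at-start = run-start a b k (trans (edge-value 0 m₀) (sym (edge-value 1 m₁)))
                             (trans (edge-value 1 m₁) (sym (edge-value 2 m₂)))

straight-map : (φ : Automorphism) → ∀ {u v w} → Straight u v w →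
  Straight (Automorphism.to φ u) (Automorphism.to φ v) (Automorphism.to φ w)
straight-map φ {u} {v} {w} (a₁ , a₂ , u≢w , unique) =
  Equivalence.to (adj u v) a₁ , Equivalence.to (adj v w) a₂ ,
  (λ eq → u≢w (trans (sym (from-to u)) (trans (cong from eq) (from-to w)))) ,
  λ z b₁ b₂ → trans (sym (to-from z)) (cong to (unique (from z) (pull u b₁) (pull w b₂)))
  where
  open Automorphism φ
  pull : ∀ x {z} → Adj (to x) z → Adj x (from z)
  pull x {z} b = Equivalence.from (adj x (from z)) (subst (Adj (to x)) (sym (to-from z)) b)

inverse : Automorphism → Automorphism
inverse φ = record
  { to = from ; from = to ; from-to = to-from ; to-from = from-to ; adj = reflect }
  where
  open Automorphism φ
  reflect : ∀ x y → Adj x y ⇔ Adj (from x) (from y)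
  reflect x y = mk⇔
    (λ a → Equivalence.from (adj (from x) (from y)) (subst₂ Adj (sym (to-from x)) (sym (to-from y)) a))
    (λ a → subst₂ Adj (to-from x) (to-from y) (Equivalence.to (adj (from x) (from y)) a))

iso-sym : ∀ {P Q} → Isomorphic P Q → Isomorphic Q P
iso-sym {P} {Q} iso = record { φ = inverse φ ; σ = flip σ ; preserves = preserves⁻¹ }
  where
  open Isomorphic iso
  open Automorphism φ
  cP cQ : ℤ² → Fin 4
  cP = BiasedPartition.colour P
  cQ = BiasedPartition.colour Q
  preserves⁻¹ : ∀ x → cP (from x) ≡ σ ⟨$⟩ˡ cQ x
  preserves⁻¹ x = begin
    cP (from x)                   ≡⟨ sym (inverseˡ σ) ⟩
    σ ⟨$⟩ˡ (σ ⟨$⟩ʳ cP (from x))   ≡⟨ cong (σ ⟨$⟩ˡ_) (sym (preserves (from x))) ⟩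
    σ ⟨$⟩ˡ cQ (to (from x))       ≡⟨ cong (λ y → σ ⟨$⟩ˡ cQ y) (to-from x) ⟩
    σ ⟨$⟩ˡ cQ x                   ∎
    where open ≡-Reasoning

marked-transfer : ∀ {P Q} n → Isomorphic P Q →
  Marked (BiasedPartition.colour P) n → Marked (BiasedPartition.colour Q) n
marked-transfer {P} {Q} n iso (p , st , m₀ , m₁ , m₂ , mₙ) =
  (λ i → to (p i)) , (λ i → straight-map φ (st i)) , mono m₀ , mono m₁ , mono m₂ , mono mₙ
  where
  open Isomorphic iso
  open Automorphism φ
  mono : ∀ {u v} → BiasedPartition.colour P u ≡ BiasedPartition.colour P v →
         BiasedPartition.colour Q (to u) ≡ BiasedPartition.colour Q (to v)
  mono eq = trans (preserves _) (trans (cong (σ ⟨$⟩ʳ_) eq) (sym (preserves _)))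

bit-transfer : ∀ a b n → Isomorphic (partitionOf a) (partitionOf b) → a n ≡ true → b n ≡ true
bit-transfer a b n iso an = marked-reads b n (marked-transfer n iso (marked-of a n an))

lemma4p6 : Σ ((ℕ → Bool) → BiasedPartition) (λ f →
             ∀ (a b : ℕ → Bool) → ¬ (∀ n → a n ≡ b n) → ¬ Isomorphic (f a) (f b))
lemma4p6 = partitionOf , λ a b a≉b iso → a≉b λ n →
  ⇔→≡ (mk⇔ (bit-transfer a b n iso) (bit-transfer b a n (iso-sym iso)))
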